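{- Let $X$ be an indeterminate and work in $\mathbb{Q}(X)$. For integers $j\ge 0$ put \[ f_j=\sum_{h}\binom{j+h}{2h}X^h,\qquad g_j=\sum_h\binom{j+h}{2h-1}X^h . \] For a positive integer $n$ let $N$ be the $n\times n$ matrix with entries \[ N_{i,j}=\binom{j-1}{i}X+\binom{j+1}{i+1},\qquad 0\le i,j<n \] (the transpose of $\bigl(\binom{i-1}{j}X+\binom{i+1}{j+1}\bigr)_{0\le i,j<n}$). Define $n\times n$ matrices $L$ and $U$ (indices $0,\dots,n-1$) by \[ L_{i,i}=1,\qquad L_{i,j}=(-1)^{i+j}\frac{g_j}{f_{j+1}}\ \ (j<i),\qquad L_{i,j}=0\ \ (j>i), \] \[ U_{j,l}=\frac{\binom lj g_j+\binom {l+1}{j+1} f_j}{f_j}. \] Then $N=LU$.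
   Context: Sums over $h$ run over all integers $h$ with finitely many nonzero terms. Binomial coefficients are $\binom{a}{b}=a(a-1)\cdots(a-b+1)/b!$ for integers $a$ and $b\ge 0$, and $\binom ab=0$ for $b<0$; in particular $\binom{ -1}{j}=(-1)^j$. Note $U_{j,l}=0$ for $j>l\ge0$. -}

module Defs where

open import Data.Nat as ℕ using (ℕ; zero; suc; _!)
open import Data.Nat.Properties using (_!≢0)
open import Data.Integer as ℤ using (ℤ; +_; -[1+_]; 0ℤ; 1ℤ)
open import Data.Fin using (Fin; toℕ)
open import Data.List using (List; []; _∷_)
open import Data.Product using (_×_; _,_; proj₁; proj₂)
open import Relation.Binary.PropositionalEquality using (_≡_)

fallingℤ : ℤ → ℕ → ℤ
fallingℤ a zero    = 1ℤ
fallingℤ a (suc k) = fallingℤ a k ℤ.* (a ℤ.- (+ k))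

binomℕ : ℤ → ℕ → ℤ
binomℕ a k = ℤ._/_ (fallingℤ a k) (+ (k !)) {{k !≢0}}

binom : ℤ → ℤ → ℤ
binom a (+ k)    = binomℕ a k
binom a -[1+ _ ] = 0ℤ

-- Polynomials in ℤ[X] as coefficient lists (constant term first).

Poly : Set
Poly = List ℤ

coeff : Poly → ℕ → ℤ
coeff []       _       = 0ℤ
coeff (a ∷ p)  zero    = a
coeff (a ∷ p)  (suc k) = coeff p k

infix 4 _≈ₚ_
_≈ₚ_ : Poly → Poly → Set
p ≈ₚ q = ∀ k → coeff p k ≡ coeff q k

infixl 6 _+ₚ_
_+ₚ_ : Poly → Poly → Poly
[]      +ₚ q       = q
(a ∷ p) +ₚ []      = a ∷ p
(a ∷ p) +ₚ (b ∷ q) = (a ℤ.+ b) ∷ (p +ₚ q)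

scaleₚ : ℤ → Poly → Poly
scaleₚ c []      = []
scaleₚ c (a ∷ p) = (c ℤ.* a) ∷ scaleₚ c p

infixl 7 _*ₚ_
_*ₚ_ : Poly → Poly → Poly
[]      *ₚ q = []
(a ∷ p) *ₚ q = scaleₚ a q +ₚ (0ℤ ∷ (p *ₚ q))

constₚ : ℤ → Poly
constₚ c = c ∷ []

monoₚ : ℤ → ℕ → Poly
monoₚ c zero    = constₚ c
monoₚ c (suc h) = 0ℤ ∷ monoₚ c h

Xₚ : Poly
Xₚ = monoₚ 1ℤ 1

-- Elements of ℚ(X) = Frac(ℤ[X]) as pairs (numerator , denominator),
-- with the usual equality a/b = c/d ⇔ a d = c b in ℤ[X].
-- (All denominators that occur below are products of the f_j, which have
-- constant term 1, hence are nonzero.)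

RatFun : Set
RatFun = Poly × Poly

infix 4 _≃_
_≃_ : RatFun → RatFun → Set
(a , b) ≃ (c , d) = a *ₚ d ≈ₚ c *ₚ b

infixl 6 _+ᵣ_
_+ᵣ_ : RatFun → RatFun → RatFun
(a , b) +ᵣ (c , d) = (a *ₚ d +ₚ c *ₚ b) , (b *ₚ d)

infixl 7 _*ᵣ_
_*ᵣ_ : RatFun → RatFun → RatFun
(a , b) *ᵣ (c , d) = (a *ₚ c) , (b *ₚ d)

polyᵣ : Poly → RatFun
polyᵣ p = p , constₚ 1ℤ

0ᵣ : RatFun
0ᵣ = polyᵣ []

1ᵣ : RatFun
1ᵣ = polyᵣ (constₚ 1ℤ)

-- Terms with h < 0 vanish (negative lower index); terms with h > j+1
-- vanish (0 ≤ j+h < 2h-1), so summing h = 0 .. j+1 gives the full sum.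

sumPoly : ℕ → (ℕ → Poly) → Poly
sumPoly zero    t = []
sumPoly (suc m) t = sumPoly m t +ₚ t m

fPoly : ℕ → Poly
fPoly j = sumPoly (suc (suc j))
  (λ h → monoₚ (binom (+ j ℤ.+ + h) (+ (2 ℕ.* h))) h)

gPoly : ℕ → Poly
gPoly j = sumPoly (suc (suc j))
  (λ h → monoₚ (binom (+ j ℤ.+ + h) (+ (2 ℕ.* h) ℤ.- 1ℤ)) h)

Nmat : ℕ → ℕ → RatFun
Nmat i j = polyᵣ (scaleₚ (binom (+ j ℤ.- 1ℤ) (+ i)) Xₚ
                  +ₚ constₚ (binom (+ suc j) (+ suc i)))

sign : ℕ → ℤ
sign zero          = 1ℤ
sign (suc zero)    = ℤ.- 1ℤ
sign (suc (suc k)) = sign k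

Lmat : ℕ → ℕ → RatFun
Lmat i j with ℕ.compare i j
... | ℕ.less _ _    = 0ᵣ
... | ℕ.equal _     = 1ᵣ
... | ℕ.greater _ _ = scaleₚ (sign (i ℕ.+ j)) (gPoly j) , fPoly (suc j)

Umat : ℕ → ℕ → RatFun
Umat j l = (scaleₚ (binom (+ l) (+ j)) (gPoly j)
            +ₚ scaleₚ (binom (+ suc l) (+ suc j)) (fPoly j)) , fPoly j

sumRat : ℕ → (ℕ → RatFun) → RatFun
sumRat zero    t = 0ᵣ
sumRat (suc m) t = sumRat m t +ᵣ t m

LUentry : ℕ → ℕ → ℕ → RatFun
LUentry n i l = sumRat n (λ j → Lmat i j *ᵣ Umat j l)

module Submission where

-- Fix an entry (i, l).  The partial sums S_m = Σ_{j<m} L_{i,j} U_{j,l}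
-- have closed forms
--   S_m = (-1)^(i+m) (binom(l-1,m) X f_m − binom(l,m) g_m) / f_m    (m ≤ i),
--   S_m = binom(l-1,i) X + binom(l+1,i+1) = N_{i,l}                  (m > i).
-- Below the diagonal the induction step is one polynomial identity, valid as soon as
-- f_{j+1} = f_j + g_j, g_{j+1} = g_j + X f_{j+1} and Pascal's rule hold; on the
-- diagonal the bracket telescopes into N_{i,l}; above it L vanishes.
--
-- To use the ring solver, polynomials are read as coefficient series in the
-- commutative ring ℤ⟦X⟧, and elements of ℚ(X) as fractions of series compared by
-- cross-multiplication.  All denominators have constant term 1, hence can be
-- cancelled, which is what makes this comparison transitive along the induction.

open import Defs
open import Data.Nat using (ℕ; _≤_)
open import Data.Fin using (Fin; toℕ)
open import Data.Fin.Properties using (toℕ<n)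
open import Algebra.Bundles using (CommutativeRing)


-- Fractions a/b over a commutative ring, with a/b ∼ a′/b′ meaning a b′ = a′ b.
-- Without cancellation this relation need not be transitive; ∼-trans below uses
-- a cancellable middle denominator.
module Fractions {c ℓ} (R : CommutativeRing c ℓ) where

  open import Data.Product using (_×_; _,_; proj₂)
  open import Level using (_⊔_)
  open CommutativeRing R
  open import Algebra.Solver.Ring.NaturalCoefficients.Default commutativeSemiring
  open import Relation.Binary.Reasoning.Setoid setoid

  Frac : Set c
  Frac = Carrier × Carrier

  infix 4 _∼_ _≋_
  _∼_ : Frac → Frac → Set ℓ
  (a , b) ∼ (a′ , b′) = a * b′ ≈ a′ * b

  _≋_ : Frac → Frac → Set ℓ
  (a , b) ≋ (a′ , b′) = a ≈ a′ × b ≈ b′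

  infixl 6 _⊞_
  _⊞_ : Frac → Frac → Frac
  (a , b) ⊞ (a′ , b′) = a * b′ + a′ * b , b * b′

  infixl 7 _⊠_
  _⊠_ : Frac → Frac → Frac
  (a , b) ⊠ (a′ , b′) = a * a′ , b * b′

  ∼-refl : ∀ {p} → p ∼ p
  ∼-refl = refl

  ∼-sym : ∀ {p q} → p ∼ q → q ∼ p
  ∼-sym = sym

  ≋-sym : ∀ {p q} → p ≋ q → q ≋ p
  ≋-sym (a≈a′ , b≈b′) = sym a≈a′ , sym b≈b′

  ∼-respʳ-≋ : ∀ {p q q′} → p ∼ q → q ≋ q′ → p ∼ q′
  ∼-respʳ-≋ {a , b} {a′ , b′} {a″ , b″} ab′≈a′b (a′≈a″ , b′≈b″) = begin
    a * b″  ≈⟨ *-congˡ b′≈b″ ⟨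
    a * b′  ≈⟨ ab′≈a′b ⟩
    a′ * b  ≈⟨ *-congʳ a′≈a″ ⟩
    a″ * b  ∎

  ∼-respˡ-≋ : ∀ {p p′ q} → p ≋ p′ → p′ ∼ q → p ∼ q
  ∼-respˡ-≋ p≋p′ p′∼q = ∼-sym (∼-respʳ-≋ (∼-sym p′∼q) (≋-sym p≋p′))

  ≋⇒∼ : ∀ {p q} → p ≋ q → p ∼ q
  ≋⇒∼ = ∼-respʳ-≋ ∼-refl

  Cancellable : Carrier → Set (c ⊔ ℓ)
  Cancellable e = ∀ {x y} → x * e ≈ y * e → x ≈ y

  *-cancellable : ∀ {e e′} → Cancellable e → Cancellable e′ → Cancellable (e * e′)
  *-cancellable {e} {e′} cancel-e cancel-e′ {x} {y} xee′≈yee′ =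
    cancel-e (cancel-e′ (trans (*-assoc x e e′) (trans xee′≈yee′ (sym (*-assoc y e e′)))))

  -- a/b = a′/b′ = a″/b″ gives (a b″) b′ = (a″ b) b′; cancel b′.
  ∼-trans : ∀ {p q r} → Cancellable (proj₂ q) → p ∼ q → q ∼ r → p ∼ r
  ∼-trans {a , b} {a′ , b′} {a″ , b″} cancel ab′≈a′b a′b″≈a″b′ = cancel (begin
    a * b″ * b′   ≈⟨ solve 3 (λ x y z → x :* y :* z := x :* z :* y) refl a b″ b′ ⟩
    a * b′ * b″   ≈⟨ *-congʳ ab′≈a′b ⟩
    a′ * b * b″   ≈⟨ solve 3 (λ x y z → x :* y :* z := x :* z :* y) refl a′ b b″ ⟩
    a′ * b″ * b   ≈⟨ *-congʳ a′b″≈a″b′ ⟩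
    a″ * b′ * b   ≈⟨ solve 3 (λ x y z → x :* y :* z := x :* z :* y) refl a″ b′ b ⟩
    a″ * b * b′   ∎)

  ⊞-cong : ∀ {p p′ q q′} → p ∼ p′ → q ∼ q′ → p ⊞ q ∼ p′ ⊞ q′
  ⊞-cong {a , b} {a′ , b′} {c , d} {c′ , d′} ab′≈a′b cd′≈c′d = begin
    (a * d + c * b) * (b′ * d′)
      ≈⟨ solve 6 (λ a b c d b′ d′ → (a :* d :+ c :* b) :* (b′ :* d′)
                                    := a :* b′ :* (d :* d′) :+ c :* d′ :* (b :* b′))
               refl a b c d b′ d′ ⟩
    a * b′ * (d * d′) + c * d′ * (b * b′)
      ≈⟨ +-cong (*-congʳ ab′≈a′b) (*-congʳ cd′≈c′d) ⟩
    a′ * b * (d * d′) + c′ * d * (b * b′)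
      ≈⟨ solve 6 (λ a′ b c′ d b′ d′ → a′ :* b :* (d :* d′) :+ c′ :* d :* (b :* b′)
                                      := (a′ :* d′ :+ c′ :* b′) :* (b :* d))
               refl a′ b c′ d b′ d′ ⟩
    (a′ * d′ + c′ * b′) * (b * d) ∎

  ⊠-cong : ∀ {p p′ q q′} → p ∼ p′ → q ∼ q′ → p ⊠ q ∼ p′ ⊠ q′
  ⊠-cong {a , b} {a′ , b′} {c , d} {c′ , d′} ab′≈a′b cd′≈c′d = begin
    a * c * (b′ * d′)   ≈⟨ solve 4 (λ a c b′ d′ → a :* c :* (b′ :* d′) := a :* b′ :* (c :* d′))
                                 refl a c b′ d′ ⟩
    a * b′ * (c * d′)   ≈⟨ *-cong ab′≈a′b cd′≈c′d ⟩
    a′ * b * (c′ * d)   ≈⟨ solve 4 (λ a′ b c′ d → a′ :* b :* (c′ :* d) := a′ :* c′ :* (b :* d))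
                                 refl a′ b c′ d ⟩
    a′ * c′ * (b * d)   ∎

  ⊞-over-multiple : ∀ {x y z b c} → x * c + y ≈ z * b → (z , c) ∼ (x , b) ⊞ (y , c * b)
  ⊞-over-multiple {x} {y} {z} {b} {c} xc+y≈zb = begin
    z * (b * (c * b))          ≈⟨ solve 3 (λ z b c → z :* (b :* (c :* b)) := z :* b :* (b :* c))
                                        refl z b c ⟩
    z * b * (b * c)            ≈⟨ *-congʳ xc+y≈zb ⟨
    (x * c + y) * (b * c)      ≈⟨ solve 4 (λ x y b c → (x :* c :+ y) :* (b :* c)
                                                     := (x :* (c :* b) :+ y :* b) :* c)
                                        refl x y b c ⟩
    (x * (c * b) + y * b) * c  ∎

  ⊞-zero : ∀ {x b y d} → y ≈ 0# → (x , b) ∼ (x , b) ⊞ (y , d)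
  ⊞-zero {x} {b} {y} {d} y≈0 = begin
    x * (b * d)             ≈⟨ solve 3 (λ x b d → x :* (b :* d) := (x :* d :+ con 0 :* b) :* b)
                                     refl x b d ⟩
    (x * d + 0# * b) * b    ≈⟨ *-congʳ (+-congˡ (*-congʳ y≈0)) ⟨
    (x * d + y * b) * b     ∎

  numerators-zero : ∀ {a b a′ b′} → a ≈ 0# → a′ ≈ 0# → (a , b) ∼ (a′ , b′)
  numerators-zero {a} {b} {a′} {b′} a≈0 a′≈0 = begin
    a * b′    ≈⟨ *-congʳ a≈0 ⟩
    0# * b′   ≈⟨ zeroˡ b′ ⟩
    0#        ≈⟨ zeroˡ b ⟨
    0# * b    ≈⟨ *-congʳ a′≈0 ⟨
    a′ * b    ∎


module PowerSeries where

  open import Data.Nat as ℕ using (ℕ; zero; suc)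
  open import Data.Integer as ℤ using (ℤ; 0ℤ; 1ℤ; _+_; _*_; -_)
  import Data.Integer.Properties as ℤP
  open import Data.Integer.Solver using (module +-*-Solver)
  open import Data.Maybe using (Maybe; just; nothing)
  open import Data.Product using (_,_)
  open import Relation.Nullary using (yes; no)
  open import Relation.Binary.PropositionalEquality
  open import Algebra.Bundles using (CommutativeRing; AbelianGroup)
  open import Algebra.Solver.Ring.AlmostCommutativeRing
    using (fromCommutativeRing; _-Raw-AlmostCommutative⟶_)
  import Algebra.Construct.Pointwise ℕ as Pointwise
  import Algebra.Solver.Ring
  open import Algebra.Properties.Group (AbelianGroup.group ℤP.+-0-abelianGroup)
    using () renaming (∙-cancelˡ to +-cancelˡ)
  open +-*-Solver using (solve; _:+_; _:*_; _:=_)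

  Series : Set
  Series = ℕ → ℤ

  infix 4 _≐_
  _≐_ : Series → Series → Set
  a ≐ b = ∀ k → a k ≡ b k

  infixl 6 _⊕_
  _⊕_ : Series → Series → Series
  (a ⊕ b) k = a k + b k

  ⊖_ : Series → Series
  (⊖ a) k = - a k

  𝟘 : Series
  𝟘 _ = 0ℤ

  δ : ℤ → Series
  δ c zero    = c
  δ c (suc _) = 0ℤ

  tail : Series → Series
  tail a k = a (suc k)

  infixl 7 _⊛_
  _⊛_ : Series → Series → Series
  (a ⊛ b) zero    = a 0 * b 0
  (a ⊛ b) (suc k) = a 0 * b (suc k) + (tail a ⊛ b) k

  scale : ℤ → Series → Series
  scale x a k = x * a k

  ⊛-cong : ∀ {a a′ b b′} → a ≐ a′ → b ≐ b′ → a ⊛ b ≐ a′ ⊛ b′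
  ⊛-cong a≐ b≐ zero    = cong₂ _*_ (a≐ 0) (b≐ 0)
  ⊛-cong a≐ b≐ (suc k) =
    cong₂ _+_ (cong₂ _*_ (a≐ 0) (b≐ (suc k))) (⊛-cong (λ i → a≐ (suc i)) b≐ k)

  -- Congruences, with the fixed operand explicit (it cannot be inferred by
  -- unification, since series are functions).
  ⊕-congˡ : ∀ a {b b′} → b ≐ b′ → a ⊕ b ≐ a ⊕ b′
  ⊕-congˡ a b≐b′ k = cong (_+_ (a k)) (b≐b′ k)

  ⊕-congʳ : ∀ b {a a′} → a ≐ a′ → a ⊕ b ≐ a′ ⊕ b
  ⊕-congʳ b a≐a′ k = cong (_+ b k) (a≐a′ k)

  ⊖-cong : ∀ {a a′} → a ≐ a′ → ⊖ a ≐ ⊖ a′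
  ⊖-cong a≐a′ k = cong -_ (a≐a′ k)

  ⊛-congˡ : ∀ a {b b′} → b ≐ b′ → a ⊛ b ≐ a ⊛ b′
  ⊛-congˡ a b≐b′ = ⊛-cong {a} {a} (λ _ → refl) b≐b′

  ⊛-congʳ : ∀ b {a a′} → a ≐ a′ → a ⊛ b ≐ a′ ⊛ b
  ⊛-congʳ b a≐a′ = ⊛-cong {b = b} {b′ = b} a≐a′ (λ _ → refl)

  ⊛-zeroˡ : ∀ b → 𝟘 ⊛ b ≐ 𝟘
  ⊛-zeroˡ b zero    = refl
  ⊛-zeroˡ b (suc k) = trans (ℤP.+-identityˡ _) (⊛-zeroˡ b k)

  δ-⊛ : ∀ x b → δ x ⊛ b ≐ scale x b
  δ-⊛ x b zero    = refl
  δ-⊛ x b (suc k) = trans (cong (x * b (suc k) +_) (⊛-zeroˡ b k)) (ℤP.+-identityʳ _)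

  ⊛-identityˡ : ∀ b → δ 1ℤ ⊛ b ≐ b
  ⊛-identityˡ b k = trans (δ-⊛ 1ℤ b k) (ℤP.*-identityˡ (b k))

  ⊛-distribʳ : ∀ c a b → (a ⊕ b) ⊛ c ≐ a ⊛ c ⊕ b ⊛ c
  ⊛-distribʳ c a b zero    = ℤP.*-distribʳ-+ (c 0) (a 0) (b 0)
  ⊛-distribʳ c a b (suc k) = begin
    (a 0 + b 0) * c (suc k) + ((tail a ⊕ tail b) ⊛ c) k
      ≡⟨ cong ((a 0 + b 0) * c (suc k) +_) (⊛-distribʳ c (tail a) (tail b) k) ⟩
    (a 0 + b 0) * c (suc k) + ((tail a ⊛ c) k + (tail b ⊛ c) k)
      ≡⟨ solve 5 (λ x y z u v → (x :+ y) :* z :+ (u :+ v) := (x :* z :+ u) :+ (y :* z :+ v))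
               refl (a 0) (b 0) (c (suc k)) ((tail a ⊛ c) k) ((tail b ⊛ c) k) ⟩
    (a ⊛ c) (suc k) + (b ⊛ c) (suc k) ∎
    where open ≡-Reasoning

  ⊛-scale : ∀ x a b → scale x a ⊛ b ≐ scale x (a ⊛ b)
  ⊛-scale x a b zero    = ℤP.*-assoc x (a 0) (b 0)
  ⊛-scale x a b (suc k) = begin
    x * a 0 * b (suc k) + (scale x (tail a) ⊛ b) k
      ≡⟨ cong (x * a 0 * b (suc k) +_) (⊛-scale x (tail a) b k) ⟩
    x * a 0 * b (suc k) + x * (tail a ⊛ b) k
      ≡⟨ solve 4 (λ x y z w → x :* y :* z :+ x :* w := x :* (y :* z :+ w))
               refl x (a 0) (b (suc k)) ((tail a ⊛ b) k) ⟩
    x * (a ⊛ b) (suc k) ∎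
    where open ≡-Reasoning

  ⊛-last : ∀ a b k → (a ⊛ b) (suc k) ≡ (a ⊛ tail b) k + a (suc k) * b 0
  ⊛-last a b zero    = refl
  ⊛-last a b (suc k) = begin
    a 0 * b (suc (suc k)) + (tail a ⊛ b) (suc k)
      ≡⟨ cong (a 0 * b (suc (suc k)) +_) (⊛-last (tail a) b k) ⟩
    a 0 * b (suc (suc k)) + ((tail a ⊛ tail b) k + a (suc (suc k)) * b 0)
      ≡⟨ ℤP.+-assoc (a 0 * b (suc (suc k))) _ _ ⟨
    (a ⊛ tail b) (suc k) + a (suc (suc k)) * b 0 ∎
    where open ≡-Reasoning

  ⊛-comm : ∀ a b → a ⊛ b ≐ b ⊛ a
  ⊛-comm a b zero    = ℤP.*-comm (a 0) (b 0)
  ⊛-comm a b (suc k) = begin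
    a 0 * b (suc k) + (tail a ⊛ b) k   ≡⟨ cong (a 0 * b (suc k) +_) (⊛-comm (tail a) b k) ⟩
    a 0 * b (suc k) + (b ⊛ tail a) k   ≡⟨ ℤP.+-comm (a 0 * b (suc k)) _ ⟩
    (b ⊛ tail a) k + a 0 * b (suc k)   ≡⟨ cong ((b ⊛ tail a) k +_) (ℤP.*-comm (a 0) (b (suc k))) ⟩
    (b ⊛ tail a) k + b (suc k) * a 0   ≡⟨ ⊛-last b a k ⟨
    (b ⊛ a) (suc k)                    ∎
    where open ≡-Reasoning

  tail-⊛ : ∀ a b → tail (a ⊛ b) ≐ tail a ⊛ b ⊕ scale (a 0) (tail b)
  tail-⊛ a b k = ℤP.+-comm (a 0 * b (suc k)) ((tail a ⊛ b) k)

  ⊛-assoc : ∀ a b c → (a ⊛ b) ⊛ c ≐ a ⊛ (b ⊛ c)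
  ⊛-assoc a b c zero    = ℤP.*-assoc (a 0) (b 0) (c 0)
  ⊛-assoc a b c (suc k) = begin
    a 0 * b 0 * c (suc k) + (tail (a ⊛ b) ⊛ c) k
      ≡⟨ cong (a 0 * b 0 * c (suc k) +_) (⊛-cong (tail-⊛ a b) (λ _ → refl) k) ⟩
    a 0 * b 0 * c (suc k) + ((tail a ⊛ b ⊕ scale (a 0) (tail b)) ⊛ c) k
      ≡⟨ cong (a 0 * b 0 * c (suc k) +_) (⊛-distribʳ c _ _ k) ⟩
    a 0 * b 0 * c (suc k) + (((tail a ⊛ b) ⊛ c) k + (scale (a 0) (tail b) ⊛ c) k)
      ≡⟨ cong₂ (λ u v → a 0 * b 0 * c (suc k) + (u + v))
               (⊛-assoc (tail a) b c k) (⊛-scale (a 0) (tail b) c k) ⟩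
    a 0 * b 0 * c (suc k) + ((tail a ⊛ (b ⊛ c)) k + a 0 * (tail b ⊛ c) k)
      ≡⟨ solve 5 (λ x y z u v → x :* y :* z :+ (u :+ x :* v) := x :* (y :* z :+ v) :+ u)
               refl (a 0) (b 0) (c (suc k)) ((tail a ⊛ (b ⊛ c)) k) ((tail b ⊛ c) k) ⟩
    (a ⊛ (b ⊛ c)) (suc k) ∎
    where open ≡-Reasoning

  ℤ⟦X⟧ : CommutativeRing _ _
  ℤ⟦X⟧ = record
    { Carrier = Series ; _≈_ = _≐_ ; _+_ = _⊕_ ; _*_ = _⊛_ ; -_ = ⊖_ ; 0# = 𝟘 ; 1# = δ 1ℤ
    ; isCommutativeRing = record
      { isRing = record
        { +-isAbelianGroup = Pointwise.isAbelianGroup ℤP.+-0-isAbelianGroup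
        ; *-cong           = ⊛-cong
        ; *-assoc          = ⊛-assoc
        ; *-identity       = ⊛-identityˡ , λ a k → trans (⊛-comm a (δ 1ℤ) k) (⊛-identityˡ a k)
        ; distrib          = (λ c a b k → trans (⊛-comm c (a ⊕ b) k)
                                           (trans (⊛-distribʳ c a b k)
                                             (cong₂ _+_ (⊛-comm a c k) (⊛-comm b c k))))
                           , ⊛-distribʳ
        }
      ; *-comm = ⊛-comm
      }
    }

  δ-cong : ∀ {x y} → x ≡ y → δ x ≐ δ y
  δ-cong x≡y k = cong (λ z → δ z k) x≡y

  δ-+ : ∀ x y → δ (x + y) ≐ δ x ⊕ δ y
  δ-+ x y zero    = refl
  δ-+ x y (suc k) = refl

  δ-* : ∀ x y → δ (x * y) ≐ δ x ⊛ δ y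
  δ-* x y zero    = refl
  δ-* x y (suc k) = sym (trans (δ-⊛ x (δ y) (suc k)) (ℤP.*-zeroʳ x))

  δ-neg : ∀ x → δ (- x) ≐ ⊖ δ x
  δ-neg x zero    = refl
  δ-neg x (suc k) = refl

  δ-zero : δ 0ℤ ≐ 𝟘
  δ-zero zero    = refl
  δ-zero (suc k) = refl

  -- The constant series δ is a ring morphism ℤ → ℤ⟦X⟧, which lets the ring
  -- solver use integer coefficients.
  δ-morphism : ℤ.+-*-rawRing -Raw-AlmostCommutative⟶ fromCommutativeRing ℤ⟦X⟧
  δ-morphism = record
    { ⟦_⟧    = δ
    ; +-homo = δ-+
    ; *-homo = δ-*
    ; -‿homo = δ-neg
    ; 0-homo = δ-zero
    ; 1-homo = λ { zero → refl ; (suc k) → refl }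
    }

  δ-dec : ∀ x y → Maybe (δ x ≐ δ y)
  δ-dec x y with x ℤP.≟ y
  ... | yes refl = just (λ _ → refl)
  ... | no  _    = nothing

  module ℤ⟦X⟧-Solver =
    Algebra.Solver.Ring ℤ.+-*-rawRing (fromCommutativeRing ℤ⟦X⟧) δ-morphism δ-dec

  ⊛-cancelʳ : ∀ {c} → c 0 ≡ 1ℤ → ∀ {a b} → a ⊛ c ≐ b ⊛ c → a ≐ b
  ⊛-cancelʳ {c} c₀≡1 {a} {b} ac≐bc = cancel
    where
    a₀≡b₀ : a 0 ≡ b 0
    a₀≡b₀ = begin
      a 0        ≡⟨ ℤP.*-identityʳ (a 0) ⟨
      a 0 * 1ℤ   ≡⟨ cong (a 0 *_) c₀≡1 ⟨
      a 0 * c 0  ≡⟨ ac≐bc 0 ⟩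
      b 0 * c 0  ≡⟨ cong (b 0 *_) c₀≡1 ⟩
      b 0 * 1ℤ   ≡⟨ ℤP.*-identityʳ (b 0) ⟩
      b 0        ∎
      where open ≡-Reasoning

    tails : tail a ⊛ c ≐ tail b ⊛ c
    tails k = +-cancelˡ (a 0 * c (suc k)) _ _
                (trans (ac≐bc (suc k)) (cong (λ x → x * c (suc k) + (tail b ⊛ c) k) (sym a₀≡b₀)))

    cancel : a ≐ b
    cancel zero    = a₀≡b₀
    cancel (suc k) = ⊛-cancelʳ c₀≡1 tails k


module BinomialCoefficients where

  open import Data.Nat as ℕ using (ℕ; zero; suc; _!; _≤_; _<_; _≤ᵇ_)
  import Data.Nat.Properties as ℕP
  open import Data.Nat.Properties using (_!≢0)
  import Data.Nat.DivMod as ℕD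
  open import Data.Nat.Combinatorics using (_C_; k>n⇒nCk≡0; nCk≡nPk/k!; nCk+nC[k+1]≡[n+1]C[k+1])
  open import Data.Nat.Combinatorics.Base using (_P_; _P′_)
  open import Data.Integer as ℤ using (ℤ; +_; -[1+_]; 0ℤ; 1ℤ; _+_; _*_; -_; _-_; _/_; _/ℕ_)
  import Data.Integer.Properties as ℤP
  open import Data.Integer.DivMod using (div-pos-is-/ℕ)
  open import Data.Integer.Solver using (module +-*-Solver)
  open import Data.Bool using (true; false; T)
  open import Data.Sum using (inj₁; inj₂)
  open import Relation.Binary.PropositionalEquality
  open import Relation.Nullary.Negation using (contradiction)

  sign-suc : ∀ k → sign (suc k) ≡ - sign k
  sign-suc zero          = refl
  sign-suc (suc zero)    = refl
  sign-suc (suc (suc k)) = sign-suc k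

  sign-double : ∀ k → sign (k ℕ.+ k) ≡ 1ℤ
  sign-double zero    = refl
  sign-double (suc k) = trans (cong (λ t → sign (suc t)) (ℕP.+-suc k k)) (sign-double k)

  *-/-cancel : ∀ x d .{{_ : ℕ.NonZero d}} → (x * + d) / + d ≡ x
  *-/-cancel x d = trans (div-pos-is-/ℕ (x * + d) d) (cancel x d)
    where
    neg-exact : ∀ m e .{{_ : ℕ.NonZero e}} → suc m ℕ.% e ≡ 0 →
                -[1+ m ] /ℕ e ≡ - + (suc m ℕ./ e)
    neg-exact m e rem≡0 with suc m ℕ.% e | rem≡0
    ... | .0 | refl = refl

    cancel : ∀ x d .{{_ : ℕ.NonZero d}} → (x * + d) /ℕ d ≡ x
    cancel (+ n)    d       = trans (cong (_/ℕ d) (sym (ℤP.pos-* n d)))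
                                    (cong +_ (ℕD.m*n/n≡m n d))
    cancel -[1+ n ] (suc e) = trans (neg-exact _ (suc e) (ℕD.m*n%n≡0 (suc n) (suc e)))
                                    (cong (λ q → - + q) (ℕD.m*n/n≡m (suc n) (suc e)))

  falling-within : ∀ {n k} → k ≤ n → fallingℤ (+ n) k ≡ + (n P′ k)
  falling-within {n} {zero}  _   = refl
  falling-within {n} {suc k} k<n = begin
    fallingℤ (+ n) k * (+ n - + k)   ≡⟨ cong₂ _*_ (falling-within (ℕP.<⇒≤ k<n))
                                                 (trans (ℤP.m-n≡m⊖n n k) (ℤP.⊖-≥ (ℕP.<⇒≤ k<n))) ⟩
    + (n P′ k) * + (n ℕ.∸ k)         ≡⟨ ℤP.pos-* (n P′ k) (n ℕ.∸ k) ⟨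
    + ((n P′ k) ℕ.* (n ℕ.∸ k))       ≡⟨ cong +_ (ℕP.*-comm (n P′ k) (n ℕ.∸ k)) ⟩
    + (n P′ suc k)                   ∎
    where open ≡-Reasoning

  -- Beyond n it vanishes, because of the factor n - n.
  falling-beyond : ∀ {n k} → n < k → fallingℤ (+ n) k ≡ 0ℤ
  falling-beyond {n} {suc k} n≤k with ℕP.m≤n⇒m<n∨m≡n (ℕP.≤-pred n≤k)
  ... | inj₁ n<k  = trans (cong (_* (+ n - + k)) (falling-beyond n<k)) (ℤP.*-zeroˡ (+ n - + k))
  ... | inj₂ refl = trans (cong (fallingℤ (+ n) n *_) (ℤP.+-inverseʳ (+ n)))
                          (ℤP.*-zeroʳ (fallingℤ (+ n) n))

  -- the library's n P k is n P′ k guarded by the test k ≤ n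
  P≡P′ : ∀ {n k} → k ≤ n → n P k ≡ n P′ k
  P≡P′ {n} {k} k≤n with k ≤ᵇ n in k≤ᵇn
  ... | true  = refl
  ... | false = contradiction (ℕP.≤⇒≤ᵇ k≤n) (subst T k≤ᵇn)

  binom-ℕ : ∀ n k → binom (+ n) (+ k) ≡ + (n C k)
  binom-ℕ n k with ℕP.≤-<-connex k n
  ... | inj₁ k≤n = begin
    fallingℤ (+ n) k / + (k !)   ≡⟨ cong (_/ + (k !)) (falling-within k≤n) ⟩
    + (n P′ k) / + (k !)         ≡⟨ div-pos-is-/ℕ (+ (n P′ k)) (k !) ⟩
    + ((n P′ k) ℕ./ k !)         ≡⟨ cong (λ p → + (p ℕ./ k !)) (P≡P′ k≤n) ⟨
    + ((n P k) ℕ./ k !)          ≡⟨ cong +_ (nCk≡nPk/k! k≤n) ⟨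
    + (n C k)                    ∎
    where open ≡-Reasoning
          instance _ = k !≢0
  ... | inj₂ n<k = begin
    fallingℤ (+ n) k / + (k !)   ≡⟨ cong (_/ + (k !)) (falling-beyond n<k) ⟩
    0ℤ / + (k !)                 ≡⟨ div-pos-is-/ℕ 0ℤ (k !) ⟩
    + (0 ℕ./ k !)                ≡⟨ cong +_ (ℕD.0/n≡0 (k !)) ⟩
    0ℤ                           ≡⟨ cong +_ (k>n⇒nCk≡0 n<k) ⟨
    + (n C k)                    ∎
    where open ≡-Reasoning
          instance _ = k !≢0

  falling-minus-one : ∀ k → fallingℤ -[1+ 0 ] k ≡ sign k * + (k !)
  falling-minus-one zero    = refl
  falling-minus-one (suc k) = begin
    fallingℤ -[1+ 0 ] k * (-[1+ 0 ] - + k)   ≡⟨ cong₂ _*_ (falling-minus-one k) (minus-one-minus k) ⟩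
    sign k * + (k !) * - + suc k             ≡⟨ solve 3 (λ s f m → s :* f :* (:- m) := (:- s) :* (m :* f))
                                                     refl (sign k) (+ (k !)) (+ suc k) ⟩
    - sign k * (+ suc k * + (k !))           ≡⟨ cong₂ _*_ (sym (sign-suc k)) (sym (ℤP.pos-* (suc k) (k !))) ⟩
    sign (suc k) * + (suc k !)               ∎
    where
    open ≡-Reasoning
    open +-*-Solver
    minus-one-minus : ∀ k → -[1+ 0 ] - + k ≡ - + suc k
    minus-one-minus zero    = refl
    minus-one-minus (suc k) = refl

  binom-minus-one : ∀ k → binom -[1+ 0 ] (+ k) ≡ sign k
  binom-minus-one k = trans (cong (_/ + (k !)) (falling-minus-one k)) (*-/-cancel (sign k) (k !))
    where instance _ = k !≢0

  pascal : ∀ n k → + (suc n C suc k) ≡ + (n C k) + + (n C suc k)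
  pascal n k = trans (cong +_ (sym (nCk+nC[k+1]≡[n+1]C[k+1] n k))) (ℤP.pos-+ (n C k) (n C suc k))

  binom-pascal : ∀ l m → binom (+ suc l) (+ suc m) ≡ binom (+ l) (+ m) + binom (+ l) (+ suc m)
  binom-pascal l m = trans (binom-ℕ (suc l) (suc m))
                       (trans (pascal l m) (sym (cong₂ _+_ (binom-ℕ l m) (binom-ℕ l (suc m)))))

  -- ... and for upper index l - 1 ≥ -1, where l = 0 needs binom(-1, k) = (-1)^k.
  binom-pascal-pred : ∀ l m → binom (+ l) (+ suc m)
                            ≡ binom (+ l - 1ℤ) (+ suc m) + binom (+ l - 1ℤ) (+ m)
  binom-pascal-pred zero    m = begin
    binom (+ 0) (+ suc m)                     ≡⟨ binom-ℕ 0 (suc m) ⟩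
    0ℤ                                        ≡⟨ ℤP.+-inverseˡ (sign m) ⟨
    - sign m + sign m                         ≡⟨ cong₂ _+_ (sym (sign-suc m)) refl ⟩
    sign (suc m) + sign m                     ≡⟨ cong₂ _+_ (binom-minus-one (suc m)) (binom-minus-one m) ⟨
    binom -[1+ 0 ] (+ suc m) + binom -[1+ 0 ] (+ m) ∎
    where open ≡-Reasoning
  binom-pascal-pred (suc l) m = begin
    binom (+ suc l) (+ suc m)                 ≡⟨ binom-pascal l m ⟩
    binom (+ l) (+ m) + binom (+ l) (+ suc m) ≡⟨ ℤP.+-comm (binom (+ l) (+ m)) _ ⟩
    binom (+ l) (+ suc m) + binom (+ l) (+ m) ∎
    where open ≡-Reasoning


module PolynomialsAsSeries where

  open PowerSeries
  open BinomialCoefficients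
  open import Data.Nat as ℕ using (ℕ; zero; suc; _≤_; _<_; z≤n; s≤s)
  import Data.Nat.Properties as ℕP
  open import Data.Nat.Combinatorics using (_C_; k>n⇒nCk≡0)
  open import Data.Integer as ℤ using (ℤ; +_; 0ℤ; 1ℤ; _+_; _*_; _-_)
  import Data.Integer.Properties as ℤP
  open import Data.List using ([]; _∷_)
  open import Data.Empty using (⊥-elim)
  open import Data.Sum using (inj₁; inj₂)
  open import Relation.Nullary using (yes; no)
  open import Relation.Binary.PropositionalEquality

  ⟦_⟧ : Poly → Series
  ⟦ p ⟧ = coeff p

  coeff-+ : ∀ p q → ⟦ p +ₚ q ⟧ ≐ ⟦ p ⟧ ⊕ ⟦ q ⟧
  coeff-+ []      q       k       = sym (ℤP.+-identityˡ (coeff q k))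
  coeff-+ (a ∷ p) []      k       = sym (ℤP.+-identityʳ (coeff (a ∷ p) k))
  coeff-+ (a ∷ p) (b ∷ q) zero    = refl
  coeff-+ (a ∷ p) (b ∷ q) (suc k) = coeff-+ p q k

  coeff-scale : ∀ c p → ⟦ scaleₚ c p ⟧ ≐ δ c ⊛ ⟦ p ⟧
  coeff-scale c p k = trans (pointwise c p k) (sym (δ-⊛ c ⟦ p ⟧ k))
    where
    pointwise : ∀ c p → ⟦ scaleₚ c p ⟧ ≐ scale c ⟦ p ⟧
    pointwise c []      k       = sym (ℤP.*-zeroʳ c)
    pointwise c (a ∷ p) zero    = refl
    pointwise c (a ∷ p) (suc k) = pointwise c p k

  coeff-* : ∀ p q → ⟦ p *ₚ q ⟧ ≐ ⟦ p ⟧ ⊛ ⟦ q ⟧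
  coeff-* []      q k       = sym (⊛-zeroˡ ⟦ q ⟧ k)
  coeff-* (a ∷ p) q zero    = trans (coeff-+ (scaleₚ a q) (0ℤ ∷ (p *ₚ q)) zero)
                                (trans (ℤP.+-identityʳ _) (coeff-scale a q 0))
  coeff-* (a ∷ p) q (suc k) = trans (coeff-+ (scaleₚ a q) (0ℤ ∷ (p *ₚ q)) (suc k))
                                (cong₂ _+_ (trans (coeff-scale a q (suc k)) (δ-⊛ a ⟦ q ⟧ (suc k)))
                                           (coeff-* p q k))

  coeff-const : ∀ c → ⟦ constₚ c ⟧ ≐ δ c
  coeff-const c zero    = refl
  coeff-const c (suc k) = refl

  sumMono : ℕ → (ℕ → ℤ) → Poly
  sumMono m φ = sumPoly m (λ h → monoₚ (φ h) h)

  coeff-mono-same : ∀ c h → coeff (monoₚ c h) h ≡ c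
  coeff-mono-same c zero    = refl
  coeff-mono-same c (suc h) = coeff-mono-same c h

  coeff-mono-other : ∀ c {h k} → h ≢ k → coeff (monoₚ c h) k ≡ 0ℤ
  coeff-mono-other c {zero}  {zero}  h≢k = ⊥-elim (h≢k refl)
  coeff-mono-other c {zero}  {suc k} h≢k = refl
  coeff-mono-other c {suc h} {zero}  h≢k = refl
  coeff-mono-other c {suc h} {suc k} h≢k = coeff-mono-other c (λ h≡k → h≢k (cong suc h≡k))

  coeff-sumMono-below : ∀ φ {m k} → k < m → coeff (sumMono m φ) k ≡ φ k
  coeff-sumMono-beyond : ∀ φ {m k} → m ≤ k → coeff (sumMono m φ) k ≡ 0ℤ
  coeff-sumMono-below φ {suc m} {k} k<1+m with ℕP.m≤n⇒m<n∨m≡n (ℕP.≤-pred k<1+m)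
  ... | inj₁ k<m  = trans (coeff-+ (sumMono m φ) (monoₚ (φ m) m) k)
                      (trans (cong₂ _+_ (coeff-sumMono-below φ k<m)
                                        (coeff-mono-other (φ m) (λ m≡k → ℕP.<-irrefl (sym m≡k) k<m)))
                             (ℤP.+-identityʳ (φ k)))
  ... | inj₂ refl = trans (coeff-+ (sumMono m φ) (monoₚ (φ m) m) m)
                      (trans (cong₂ _+_ (coeff-sumMono-beyond φ {m} ℕP.≤-refl) (coeff-mono-same (φ m) m))
                             (ℤP.+-identityˡ (φ m)))
  coeff-sumMono-beyond φ {zero}  _     = refl
  coeff-sumMono-beyond φ {suc m} {k} m<k = trans (coeff-+ (sumMono m φ) (monoₚ (φ m) m) k)
    (cong₂ _+_ (coeff-sumMono-beyond φ (ℕP.<⇒≤ m<k))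
               (coeff-mono-other (φ m) (λ m≡k → ℕP.<-irrefl m≡k m<k)))

  coeff-sumMono : ∀ φ m → (∀ k → m ≤ k → φ k ≡ 0ℤ) → ⟦ sumMono m φ ⟧ ≐ φ
  coeff-sumMono φ m vanish k with k ℕ.<? m
  ... | yes k<m = coeff-sumMono-below φ k<m
  ... | no  k≮m = trans (coeff-sumMono-beyond φ (ℕP.≮⇒≥ k≮m)) (sym (vanish k (ℕP.≮⇒≥ k≮m)))

  X : Series
  X = ⟦ Xₚ ⟧

  X-shift-zero : ∀ a → (X ⊛ a) 0 ≡ 0ℤ
  X-shift-zero a = ℤP.*-zeroˡ (a 0)

  X-shift : ∀ a k → (X ⊛ a) (suc k) ≡ a k
  X-shift a k = trans (cong₂ _+_ (ℤP.*-zeroˡ (a (suc k))) (⊛-cong (coeff-const 1ℤ) (λ _ → refl) k))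
                      (trans (ℤP.+-identityˡ _) (⊛-identityˡ a k))

  F G : ℕ → Series
  F zero    = δ 1ℤ
  F (suc j) = F j ⊕ G j
  G zero    = X
  G (suc j) = G j ⊕ X ⊛ F (suc j)

  F-const : ∀ j → F j 0 ≡ 1ℤ
  G-const : ∀ j → G j 0 ≡ 0ℤ
  F-const zero    = refl
  F-const (suc j) = cong₂ _+_ (F-const j) (G-const j)
  G-const zero    = refl
  G-const (suc j) = cong₂ _+_ (G-const j) (X-shift-zero (F (suc j)))

  fCoeff gCoeff : ℕ → Series
  fCoeff j k       = + ((j ℕ.+ k) C (2 ℕ.* k))
  gCoeff j zero    = 0ℤ
  gCoeff j (suc k) = + ((j ℕ.+ suc k) C suc (2 ℕ.* k))

  double-suc : ∀ k → 2 ℕ.* suc k ≡ suc (suc (2 ℕ.* k))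
  double-suc k = cong suc (ℕP.+-suc k (k ℕ.+ 0))

  sum<double : ∀ {j k} → j < k → j ℕ.+ k < 2 ℕ.* k
  sum<double {j} {k} j<k = subst (j ℕ.+ k <_) (cong (k ℕ.+_) (sym (ℕP.+-identityʳ k)))
                                 (ℕP.+-monoˡ-< k j<k)

  fPoly-closed : ∀ j → ⟦ fPoly j ⟧ ≐ fCoeff j
  fPoly-closed j k = trans (coeff-sumMono _ (suc (suc j)) vanish k) (binom-ℕ (j ℕ.+ k) (2 ℕ.* k))
    where
    vanish : ∀ h → suc (suc j) ≤ h → binom (+ (j ℕ.+ h)) (+ (2 ℕ.* h)) ≡ 0ℤ
    vanish h 2+j≤h = trans (binom-ℕ (j ℕ.+ h) (2 ℕ.* h))
                           (cong +_ (k>n⇒nCk≡0 (sum<double (ℕP.<-trans (ℕP.n<1+n j) 2+j≤h))))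

  gPoly-closed : ∀ j → ⟦ gPoly j ⟧ ≐ gCoeff j
  gPoly-closed j k = trans (coeff-sumMono _ (suc (suc j)) vanish k) (closed k)
    where
    φ : ℕ → ℤ
    φ h = binom (+ (j ℕ.+ h)) (+ (2 ℕ.* h) - 1ℤ)
    φ-suc : ∀ k → φ (suc k) ≡ + ((j ℕ.+ suc k) C suc (2 ℕ.* k))
    φ-suc k = trans (cong (λ t → binom (+ (j ℕ.+ suc k)) (+ t - 1ℤ)) (double-suc k))
                    (binom-ℕ (j ℕ.+ suc k) (suc (2 ℕ.* k)))
    closed : ∀ k → φ k ≡ gCoeff j k
    closed zero    = refl
    closed (suc k) = φ-suc k
    vanish : ∀ h → suc (suc j) ≤ h → φ h ≡ 0ℤ
    vanish (suc k) (s≤s 1+j≤k) = trans (φ-suc k) (cong +_ (k>n⇒nCk≡0 beyond))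
      where
      beyond : j ℕ.+ suc k < suc (2 ℕ.* k)
      beyond = subst (_< suc (2 ℕ.* k)) (sym (ℕP.+-suc j k)) (s≤s (sum<double 1+j≤k))

  -- The closed forms satisfy the defining recurrences of f and g (Pascal's rule).
  fCoeff-zero : fCoeff 0 ≐ δ 1ℤ
  fCoeff-zero zero    = refl
  fCoeff-zero (suc k) = cong +_ (k>n⇒nCk≡0 (sum<double {0} {suc k} (s≤s z≤n)))

  gCoeff-zero : gCoeff 0 ≐ X
  gCoeff-zero zero          = refl
  gCoeff-zero (suc zero)    = refl
  gCoeff-zero (suc (suc k)) = cong +_ (k>n⇒nCk≡0 (s≤s (sum<double {0} {suc k} (s≤s z≤n))))

  fCoeff-suc : ∀ j → fCoeff (suc j) ≐ fCoeff j ⊕ gCoeff j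
  fCoeff-suc j zero    = refl
  fCoeff-suc j (suc k) = begin
    + (suc (j ℕ.+ suc k) C (2 ℕ.* suc k))
      ≡⟨ cong (λ t → + (suc (j ℕ.+ suc k) C t)) (double-suc k) ⟩
    + (suc (j ℕ.+ suc k) C suc (suc (2 ℕ.* k)))
      ≡⟨ pascal (j ℕ.+ suc k) (suc (2 ℕ.* k)) ⟩
    + ((j ℕ.+ suc k) C suc (2 ℕ.* k)) + + ((j ℕ.+ suc k) C suc (suc (2 ℕ.* k)))
      ≡⟨ ℤP.+-comm (+ ((j ℕ.+ suc k) C suc (2 ℕ.* k))) (+ ((j ℕ.+ suc k) C suc (suc (2 ℕ.* k)))) ⟩
    + ((j ℕ.+ suc k) C suc (suc (2 ℕ.* k))) + + ((j ℕ.+ suc k) C suc (2 ℕ.* k))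
      ≡⟨ cong (λ t → + ((j ℕ.+ suc k) C t) + gCoeff j (suc k)) (double-suc k) ⟨
    fCoeff j (suc k) + gCoeff j (suc k) ∎
    where open ≡-Reasoning

  gCoeff-suc : ∀ j → gCoeff (suc j) ≐ gCoeff j ⊕ X ⊛ fCoeff (suc j)
  gCoeff-suc j zero    = sym (X-shift-zero (fCoeff (suc j)))
  gCoeff-suc j (suc k) = begin
    + (suc (j ℕ.+ suc k) C suc (2 ℕ.* k))
      ≡⟨ pascal (j ℕ.+ suc k) (2 ℕ.* k) ⟩
    + ((j ℕ.+ suc k) C (2 ℕ.* k)) + + ((j ℕ.+ suc k) C suc (2 ℕ.* k))
      ≡⟨ ℤP.+-comm (+ ((j ℕ.+ suc k) C (2 ℕ.* k))) (+ ((j ℕ.+ suc k) C suc (2 ℕ.* k))) ⟩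
    gCoeff j (suc k) + + ((j ℕ.+ suc k) C (2 ℕ.* k))
      ≡⟨ cong (λ t → gCoeff j (suc k) + + (t C (2 ℕ.* k))) (ℕP.+-suc j k) ⟩
    gCoeff j (suc k) + fCoeff (suc j) k
      ≡⟨ cong (_+_ (gCoeff j (suc k))) (X-shift (fCoeff (suc j)) k) ⟨
    gCoeff j (suc k) + (X ⊛ fCoeff (suc j)) (suc k) ∎
    where open ≡-Reasoning

  F-closed : ∀ j → F j ≐ fCoeff j
  G-closed : ∀ j → G j ≐ gCoeff j
  F-closed zero      k = sym (fCoeff-zero k)
  F-closed (suc j)   k = trans (cong₂ _+_ (F-closed j k) (G-closed j k)) (sym (fCoeff-suc j k))
  G-closed zero      k = sym (gCoeff-zero k)
  G-closed (suc j)   k = trans (cong₂ _+_ (G-closed j k) (⊛-cong (λ _ → refl) (F-closed (suc j)) k))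
                               (sym (gCoeff-suc j k))

  fPoly≐F : ∀ j → ⟦ fPoly j ⟧ ≐ F j
  fPoly≐F j k = trans (fPoly-closed j k) (sym (F-closed j k))

  gPoly≐G : ∀ j → ⟦ gPoly j ⟧ ≐ G j
  gPoly≐G j k = trans (gPoly-closed j k) (sym (G-closed j k))


module PartialSums where

  open PowerSeries
  open BinomialCoefficients
  open PolynomialsAsSeries
  open import Data.Nat as ℕ using (ℕ; zero; suc; _≤_; _<_)
  import Data.Nat.Properties as ℕP
  open import Data.Integer as ℤ using (ℤ; +_; 0ℤ; 1ℤ; _+_; _-_)
  open import Data.Product using (_,_; proj₂)
  open import Data.Sum using (inj₁; inj₂)
  open import Data.Empty using (⊥-elim)
  open import Algebra.Bundles using (CommutativeRing)
  open import Relation.Binary.PropositionalEquality using (_≡_; refl; sym; trans; cong; cong₂)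
  open Fractions ℤ⟦X⟧

  ⟦_⟧ᵣ : RatFun → Frac
  ⟦ p , d ⟧ᵣ = ⟦ p ⟧ , ⟦ d ⟧

  ⟦+ᵣ⟧ : ∀ r s → ⟦ r ⟧ᵣ ⊞ ⟦ s ⟧ᵣ ≋ ⟦ r +ᵣ s ⟧ᵣ
  ⟦+ᵣ⟧ (p , d) (q , e) =
      (λ k → sym (trans (coeff-+ (p *ₚ e) (q *ₚ d) k) (cong₂ _+_ (coeff-* p e k) (coeff-* q d k))))
    , (λ k → sym (coeff-* d e k))

  ⟦*ᵣ⟧ : ∀ r s → ⟦ r ⟧ᵣ ⊠ ⟦ s ⟧ᵣ ≋ ⟦ r *ᵣ s ⟧ᵣ
  ⟦*ᵣ⟧ (p , d) (q , e) = (λ k → sym (coeff-* p q k)) , (λ k → sym (coeff-* d e k))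

  ∼⇒≃ : ∀ r s → ⟦ r ⟧ᵣ ∼ ⟦ s ⟧ᵣ → r ≃ s
  ∼⇒≃ (p , d) (q , e) pe≐qd k = trans (coeff-* p e k) (trans (pe≐qd k) (sym (coeff-* q d k)))

  Lmat-below : ∀ {i j} → j < i → Lmat i j ≡ (scaleₚ (sign (i ℕ.+ j)) (gPoly j) , fPoly (suc j))
  Lmat-below {i} {j} j<i with ℕ.compare i j
  ... | ℕ.less _ k    = ⊥-elim (ℕP.<-asym j<i (ℕP.m≤m+n (suc i) k))
  ... | ℕ.equal _     = ⊥-elim (ℕP.<-irrefl refl j<i)
  ... | ℕ.greater _ _ = refl

  Lmat-diag : ∀ {i j} → i ≡ j → Lmat i j ≡ 1ᵣ
  Lmat-diag {i} {j} i≡j with ℕ.compare i j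
  ... | ℕ.less _ k    = ⊥-elim (ℕP.<-irrefl i≡j (ℕP.m≤m+n (suc i) k))
  ... | ℕ.equal _     = refl
  ... | ℕ.greater _ k = ⊥-elim (ℕP.<-irrefl (sym i≡j) (ℕP.m≤m+n (suc j) k))

  Lmat-above : ∀ {i j} → i < j → Lmat i j ≡ 0ᵣ
  Lmat-above {i} {j} i<j with ℕ.compare i j
  ... | ℕ.less _ _    = refl
  ... | ℕ.equal _     = ⊥-elim (ℕP.<-irrefl refl i<j)
  ... | ℕ.greater _ k = ⊥-elim (ℕP.<-asym i<j (ℕP.m≤m+n (suc j) k))

  -- The algebraic heart of the induction step: with f₁ = f + g and
  -- g₁ = g + x f₁ (the recurrences of f_j, g_j),
  --   σ (a x f − b g) f₁ + σ g (b g + (b + a₁ + a) f) = −σ (a₁ x f₁ − (a₁ + a) g₁) f.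
  recurrence-identity : ∀ σ a a₁ b x f g →
    σ ⊛ (a ⊛ x ⊛ f ⊕ ⊖ (b ⊛ g)) ⊛ (f ⊕ g) ⊕ σ ⊛ g ⊛ (b ⊛ g ⊕ (b ⊕ (a₁ ⊕ a)) ⊛ f)
      ≐ ⊖ σ ⊛ (a₁ ⊛ x ⊛ (f ⊕ g) ⊕ ⊖ ((a₁ ⊕ a) ⊛ (g ⊕ x ⊛ (f ⊕ g)))) ⊛ f
  recurrence-identity = solve 7 (λ σ a a₁ b x f g →
    σ :* (a :* x :* f :+ :- (b :* g)) :* (f :+ g) :+ σ :* g :* (b :* g :+ (b :+ (a₁ :+ a)) :* f)
      := :- σ :* (a₁ :* x :* (f :+ g) :+ :- ((a₁ :+ a) :* (g :+ x :* (f :+ g)))) :* f)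
    (λ _ → refl)
    where open ℤ⟦X⟧-Solver using (solve; _:+_; _:*_; :-_; _:=_)

  -- The denominators met below, products of f_j's, have constant term 1.
  F-cancellable : ∀ j → Cancellable (F j)
  F-cancellable j = ⊛-cancelʳ (F-const j)

  one-cancellable : Cancellable (δ 1ℤ)
  one-cancellable = ⊛-cancelʳ refl

  module Entry (i l : ℕ) where

    A B B′ : ℕ → Series
    A m  = δ (binom (+ l - 1ℤ) (+ m))
    B m  = δ (binom (+ l) (+ m))
    B′ m = δ (binom (+ suc l) (+ suc m))

    σ : ℕ → Series
    σ m = δ (sign (i ℕ.+ m))

    u : ℕ → Series
    u m = B m ⊛ G m ⊕ B′ m ⊛ F m

    -- For m ≤ i, the partial sum Σ_{j<m} L_{i,j} U_{j,l} equals
    -- Q m = (-1)^(i+m) (A_m X f_m − B_m g_m) / f_m.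
    R : ℕ → Series
    R m = A m ⊛ X ⊛ F m ⊕ ⊖ (B m ⊛ G m)

    Q : ℕ → Frac
    Q m = σ m ⊛ R m , F m

    N : Frac
    N = A i ⊛ X ⊕ B′ i , δ 1ℤ

    T : ℕ → RatFun
    T j = Lmat i j *ᵣ Umat j l

    S : ℕ → Frac
    S m = ⟦ sumRat m T ⟧ᵣ

    B-pascal : ∀ m → B (suc m) ≐ A (suc m) ⊕ A m
    B-pascal m k = trans (δ-cong (binom-pascal-pred l m) k) (δ-+ _ _ k)

    B′-pascal : ∀ m → B′ m ≐ B m ⊕ (A (suc m) ⊕ A m)
    B′-pascal m k = trans (δ-cong (binom-pascal l m) k)
                     (trans (δ-+ _ _ k) (cong (_+_ (B m k)) (B-pascal m k)))

    σ-suc : ∀ m → σ (suc m) ≐ ⊖ σ m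
    σ-suc m k = trans (δ-cong (trans (cong sign (ℕP.+-suc i m)) (sign-suc (i ℕ.+ m))) k)
                      (δ-neg (sign (i ℕ.+ m)) k)

    σ-diag : σ i ≐ δ 1ℤ
    σ-diag = δ-cong (sign-double i)

    ⟦U⟧ : ∀ m → (u m , F m) ≋ ⟦ Umat m l ⟧ᵣ
    ⟦U⟧ m = (λ k → sym (trans (coeff-+ (scaleₚ _ (gPoly m)) (scaleₚ _ (fPoly m)) k)
                          (cong₂ _+_ (trans (coeff-scale _ (gPoly m) k) (⊛-congˡ (B m) (gPoly≐G m) k))
                                     (trans (coeff-scale _ (fPoly m) k) (⊛-congˡ (B′ m) (fPoly≐F m) k)))))
          , (λ k → sym (fPoly≐F m k))

    ⟦L-below⟧ : ∀ {m} → m < i → (σ m ⊛ G m , F (suc m)) ≋ ⟦ Lmat i m ⟧ᵣ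
    ⟦L-below⟧ {m} m<i rewrite Lmat-below m<i =
        (λ k → sym (trans (coeff-scale _ (gPoly m) k) (⊛-congˡ (σ m) (gPoly≐G m) k)))
      , (λ k → sym (fPoly≐F (suc m) k))

    ⟦L-diag⟧ : (δ 1ℤ , δ 1ℤ) ≋ ⟦ Lmat i i ⟧ᵣ
    ⟦L-diag⟧ rewrite Lmat-diag {i} refl =
      (λ k → sym (coeff-const 1ℤ k)) , (λ k → sym (coeff-const 1ℤ k))

    ⟦L-above⟧ : ∀ {m} → i < m → (𝟘 , δ 1ℤ) ≋ ⟦ Lmat i m ⟧ᵣ
    ⟦L-above⟧ i<m rewrite Lmat-above i<m = (λ _ → refl) , (λ k → sym (coeff-const 1ℤ k))

    term : ∀ {ℓ} m → ℓ ≋ ⟦ Lmat i m ⟧ᵣ → ℓ ⊠ (u m , F m) ∼ ⟦ T m ⟧ᵣ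
    term m ℓ≋L = ∼-respʳ-≋ (⊠-cong (≋⇒∼ ℓ≋L) (≋⇒∼ (⟦U⟧ m))) (⟦*ᵣ⟧ (Lmat i m) (Umat m l))

    extend : ∀ m {q q′ t} → Cancellable (proj₂ (q ⊞ t)) →
             q′ ∼ q ⊞ t → q ∼ S m → t ∼ ⟦ T m ⟧ᵣ → q′ ∼ S (suc m)
    extend m cancel q′∼q+t q∼S t∼T =
      ∼-respʳ-≋ (∼-trans cancel q′∼q+t (⊞-cong q∼S t∼T)) (⟦+ᵣ⟧ (sumRat m T) (T m))

    below-step : ∀ m → Q (suc m) ∼ Q m ⊞ (σ m ⊛ G m , F (suc m)) ⊠ (u m , F m)
    below-step m = ⊞-over-multiple numerators
      where
      open import Relation.Binary.Reasoning.Setoid (CommutativeRing.setoid ℤ⟦X⟧)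
      numerators : σ m ⊛ R m ⊛ F (suc m) ⊕ σ m ⊛ G m ⊛ u m ≐ σ (suc m) ⊛ R (suc m) ⊛ F m
      numerators = begin
        σ m ⊛ R m ⊛ F (suc m) ⊕ σ m ⊛ G m ⊛ u m
          ≈⟨ ⊕-congˡ (σ m ⊛ R m ⊛ F (suc m))
               (⊛-congˡ (σ m ⊛ G m) (⊕-congˡ (B m ⊛ G m) (⊛-congʳ (F m) (B′-pascal m)))) ⟩
        σ m ⊛ R m ⊛ F (suc m) ⊕ σ m ⊛ G m ⊛ (B m ⊛ G m ⊕ (B m ⊕ (A (suc m) ⊕ A m)) ⊛ F m)
          ≈⟨ recurrence-identity (σ m) (A m) (A (suc m)) (B m) X (F m) (G m) ⟩
        ⊖ σ m ⊛ (A (suc m) ⊛ X ⊛ F (suc m) ⊕ ⊖ ((A (suc m) ⊕ A m) ⊛ G (suc m))) ⊛ F m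
          ≈⟨ ⊛-congʳ (F m) (⊛-cong (σ-suc m)
               (⊕-congˡ (A (suc m) ⊛ X ⊛ F (suc m)) (⊖-cong (⊛-congʳ (G (suc m)) (B-pascal m))))) ⟨
        σ (suc m) ⊛ R (suc m) ⊛ F m ∎

    diagonal-step : N ∼ Q i ⊞ (δ 1ℤ , δ 1ℤ) ⊠ (u i , F i)
    diagonal-step = ⊞-over-multiple numerators
      where
      open import Relation.Binary.Reasoning.Setoid (CommutativeRing.setoid ℤ⟦X⟧)
      open ℤ⟦X⟧-Solver using (solve; _:+_; _:*_; :-_; _:=_; con)
      numerators : σ i ⊛ R i ⊛ δ 1ℤ ⊕ δ 1ℤ ⊛ u i ≐ (A i ⊛ X ⊕ B′ i) ⊛ F i
      numerators = begin
        σ i ⊛ R i ⊛ δ 1ℤ ⊕ δ 1ℤ ⊛ u i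
          ≈⟨ ⊕-congʳ (δ 1ℤ ⊛ u i) (⊛-congʳ (δ 1ℤ) (⊛-congʳ (R i) σ-diag)) ⟩
        δ 1ℤ ⊛ R i ⊛ δ 1ℤ ⊕ δ 1ℤ ⊛ u i
          ≈⟨ solve 6 (λ a b b′ x f g →
               con 1ℤ :* (a :* x :* f :+ :- (b :* g)) :* con 1ℤ :+ con 1ℤ :* (b :* g :+ b′ :* f)
                 := (a :* x :+ b′) :* f)
               (λ _ → refl) (A i) (B i) (B′ i) X (F i) (G i) ⟩
        (A i ⊛ X ⊕ B′ i) ⊛ F i ∎

    above-step : ∀ m → N ∼ N ⊞ (𝟘 , δ 1ℤ) ⊠ (u m , F m)
    above-step m = ⊞-zero (⊛-zeroˡ (u m))

    -- The partial sums up to the diagonal; for m = 0 both sides vanish, as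
    -- R 0 = X − X.
    partial-below : ∀ m → m ≤ i → Q m ∼ S m
    partial-below zero    _   = numerators-zero R₀≐0 (λ _ → refl)
      where
      open ℤ⟦X⟧-Solver using (solve; _:+_; _:*_; :-_; _:=_; con)
      R₀≐0 : σ 0 ⊛ R 0 ≐ 𝟘
      R₀≐0 k = trans (solve 2 (λ s x → s :* (con 1ℤ :* x :* con 1ℤ :+ :- (con 1ℤ :* x)) := con 0ℤ)
                            (λ _ → refl) (σ 0) X k)
                     (δ-zero k)
    partial-below (suc m) m<i =
      extend m cancellable (below-step m) (partial-below m (ℕP.<⇒≤ m<i)) (term m (⟦L-below⟧ m<i))
      where
      cancellable : Cancellable (F m ⊛ (F (suc m) ⊛ F m))
      cancellable = *-cancellable (F-cancellable m)
                      (*-cancellable (F-cancellable (suc m)) (F-cancellable m))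

    partial-above : ∀ m → i < m → N ∼ S m
    partial-above (suc m) i<1+m with ℕP.m≤n⇒m<n∨m≡n (ℕP.≤-pred i<1+m)
    ... | inj₂ refl = extend i cancellable diagonal-step (partial-below i ℕP.≤-refl) (term i ⟦L-diag⟧)
      where
      cancellable : Cancellable (F i ⊛ (δ 1ℤ ⊛ F i))
      cancellable = *-cancellable (F-cancellable i) (*-cancellable one-cancellable (F-cancellable i))
    ... | inj₁ i<m  = extend m cancellable (above-step m) (partial-above m i<m) (term m (⟦L-above⟧ i<m))
      where
      cancellable : Cancellable (δ 1ℤ ⊛ (δ 1ℤ ⊛ F m))
      cancellable = *-cancellable one-cancellable (*-cancellable one-cancellable (F-cancellable m))

    ⟦N⟧ : ⟦ Nmat i l ⟧ᵣ ≋ N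
    ⟦N⟧ = (λ k → trans (coeff-+ (scaleₚ a Xₚ) (constₚ b′) k)
                       (cong₂ _+_ (coeff-scale a Xₚ k) (coeff-const b′ k)))
        , coeff-const 1ℤ
      where
      a b′ : ℤ
      a  = binom (+ l - 1ℤ) (+ i)
      b′ = binom (+ suc l) (+ suc i)


open PartialSums using (module Entry; ∼⇒≃)
open Fractions PowerSeries.ℤ⟦X⟧ using (∼-respˡ-≋)

-- Entry (i, l): N_{i,l} is the closed form of the full sum Σ_{j<n} L_{i,j} U_{j,l}, as n > i.
mainTheorem8 : (n : ℕ) → 1 ≤ n → (i l : Fin n) →
    Nmat (toℕ i) (toℕ l) ≃ LUentry n (toℕ i) (toℕ l)
mainTheorem8 n _ i l =
  ∼⇒≃ (Nmat (toℕ i) (toℕ l)) (LUentry n (toℕ i) (toℕ l))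
      (∼-respˡ-≋ ⟦N⟧ (partial-above n (toℕ<n i)))
  where open Entry (toℕ i) (toℕ l)
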